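{- Every $2$-coloring $G$ of the edges of the complete graph on $n\ge 6$ vertices satisfies $M(G)-A(G)\ge\frac12$.
   Context: A $2$-coloring of the edges of a complete graph assigns to each edge one of two colors, red or blue. A monochromatic complete subgraph is a set $S$ of vertices such that all edges with both endpoints in $S$ have the same color; they are counted as vertex sets, each set once, and the size of $S$ is $|S|$. $A(G)$ is the average of $|S|$ over all monochromatic complete subgraphs $S$ of $G$, and $M(G)$ is the maximum size of a monochromatic complete subgraph of $G$. -}

module Defs where

open import Data.Bool using (Bool; true; false; _∧_; _∨_; not; if_then_else_)
open import Data.Bool.Properties using () renaming (_≟_ to _≟ᵇ_)
open import Data.Nat using (ℕ; zero; suc; _⊔_; _≤ᵇ_)
open import Data.Fin using (Fin; _<?_)
open import Data.Fin.Subset using (Subset; ∣_∣)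
open import Data.Vec using (Vec; []; _∷_; lookup)
open import Data.List using (List; []; _∷_; [_]; _++_; map; filterᵇ; foldr; length; allFin)
open import Data.Bool.ListAction using (all)
open import Data.Nat.ListAction using (sum)
open import Relation.Nullary.Decidable using (⌊_⌋)

-- The colour of the edge {i,j} with i < j is  c i j  (true = red, false = blue);
-- values c i j with i ≥ j are ignored (each edge is read exactly once).
Colouring : ℕ → Set
Colouring n = Fin n → Fin n → Bool

monoIn : ∀ {n} → Colouring n → Bool → Subset n → Bool
monoIn {n} c col S =
  all (λ i → all (λ j →
         not (⌊ i <? j ⌋ ∧ lookup S i ∧ lookup S j) ∨ ⌊ c i j ≟ᵇ col ⌋)
       (allFin n)) (allFin n)

isMonoClique : ∀ {n} → Colouring n → Subset n → Bool
isMonoClique c S = (1 ≤ᵇ ∣ S ∣) ∧ (monoIn c true S ∨ monoIn c false S)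

allSubsets : (n : ℕ) → List (Subset n)
allSubsets zero = [ [] ]
allSubsets (suc n) = map (true ∷_) (allSubsets n) ++ map (false ∷_) (allSubsets n)

monoCliques : ∀ {n} → Colouring n → List (Subset n)
monoCliques {n} c = filterᵇ (isMonoClique c) (allSubsets n)

numMono : ∀ {n} → Colouring n → ℕ
numMono c = length (monoCliques c)

-- total size  Σ_S |S|  over monochromatic complete subgraphs  (A(G) = totalSize / numMono)
totalSize : ∀ {n} → Colouring n → ℕ
totalSize c = sum (map ∣_∣ (monoCliques c))

M : ∀ {n} → Colouring n → ℕ
M c = foldr _⊔_ 0 (map ∣_∣ (monoCliques c))

-- Let m = M(G); then m ≥ 3 because R(3,3) = 6. Every monochromatic clique S satisfies
-- 2|S| + 1 + [|S| = m − 1] ≤ 2m + [|S| = m], so summing over all N of them gives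
-- 2 Σ|S| + N + b ≤ 2mN + a, where a and b count the monochromatic cliques of sizes m and
-- m − 1, and it remains to show a ≤ b. Counting pairs (R, v) with v ∉ R and R ∪ {v} a clique
-- of size m gives m·a = Σ_R e(R). If e(R) > 0 then R is a clique of size m − 1 whose colour χ
-- is determined (m − 1 ≥ 2), and the extending vertices form a clique of the other colour:
-- two of them joined in colour χ would extend R to a clique of size m + 1. Hence
-- e(R) ≤ m·[R is counted by b], and m·a ≤ m·b.

module Submission where

open import Defs
open import Data.Bool using (Bool; true; false; T; T?; _∧_; _∨_; not)
open import Data.Bool.Properties using (T-∧; T-∨; T-≡; ∨-zeroʳ; ¬-not) renaming (_≟_ to _≟ᵇ_)
open import Data.Nat using (ℕ; zero; suc; _≤_; _+_; _*_; _⊔_; z≤n; s≤s; _≟_; _≤?_)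
open import Data.Nat.Properties hiding (_<?_)
open import Data.Fin as Fin using (Fin; zero; suc; _<?_)
import Data.Fin.Properties as Fin
open import Data.Fin.Subset using (Subset; ∣_∣; ∁; ⊥; _∈_; _∉_; _⊆_)
open import Data.Fin.Subset.Properties using (∣∁p∣≡n∸∣p∣; ∣p∣≤n; ∣⊥∣≡0; ∉⊥; x∈∁p⇒x∉p)
open import Data.Vec using ([]; _∷_; here; there; lookup; tabulate; _[_]≔_)
open import Data.Vec.Properties
  using ([]=⇒lookup; lookup⇒[]=; []≔-updates; []≔-minimal; lookup∘update′; lookup∘tabulate)
open import Data.List using ([]; _∷_; _++_; map; filterᵇ; foldr; length; allFin)
open import Data.List.Properties using (map-++; map-∘)
import Data.List.Membership.Propositional as List
open import Data.List.Membership.Propositional.Properties using (∈-++⁺ˡ; ∈-++⁺ʳ; ∈-map⁺; ∈-filter⁺)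
open import Data.List.Relation.Unary.Any as Any using ()
open import Data.List.Relation.Unary.All.Properties using (all⁺; all⁻; tabulate⁺; tabulate⁻)
open import Data.Bool.ListAction using (all)
open import Data.Nat.ListAction using (sum)
open import Data.Nat.ListAction.Properties using (sum-++)
open import Data.Product using (∃-syntax; _×_; _,_; proj₂)
open import Data.Sum using (_⊎_; inj₁; inj₂)
open import Data.Empty using (⊥-elim)
open import Function using (_∘_; _⇔_; mk⇔; Equivalence)
open import Relation.Nullary using (yes; no; contradiction)
open import Relation.Nullary.Decidable using (⌊_⌋; toWitness; fromWitness)
open import Relation.Binary.PropositionalEquality
open import Data.Nat.Tactic.RingSolver using (solve-∀)
open import Algebra.Properties.CommutativeSemigroup +-commutativeSemigroup using (interchange)

open Equivalence using (to; from)

iverson : Bool → ℕ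
iverson true  = 1
iverson false = 0

iverson-T : ∀ {b} → T b → iverson b ≡ 1
iverson-T {true} _ = refl

iverson-∧ : ∀ x y → iverson (x ∧ y) ≡ iverson x * iverson y
iverson-∧ true  y = sym (+-identityʳ (iverson y))
iverson-∧ false y = refl

T-all-allFin : ∀ {n} {p : Fin n → Bool} → T (all p (allFin n)) ⇔ (∀ i → T (p i))
T-all-allFin {n} {p} = mk⇔ (tabulate⁻ ∘ all⁺ p (allFin n)) (all⁻ p ∘ tabulate⁺)

Mono : ∀ {n} → Colouring n → Bool → Subset n → Set
Mono c col S = ∀ {i j} → i Fin.< j → i ∈ S → j ∈ S → c i j ≡ col

MonoClique : ∀ {n} → Colouring n → Subset n → Set
MonoClique c S = 1 ≤ ∣ S ∣ × ∃[ col ] Mono c col S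

module _ {n} (c : Colouring n) (col : Bool) (S : Subset n) where

  private
    EdgeOK : Fin n → Fin n → Set
    EdgeOK i j = i Fin.< j → i ∈ S → j ∈ S → c i j ≡ col

    T-edgeOK : ∀ i j → T (not (⌊ i <? j ⌋ ∧ lookup S i ∧ lookup S j) ∨ ⌊ c i j ≟ᵇ col ⌋) ⇔ EdgeOK i j
    T-edgeOK i j = mk⇔ sound complete
      where
      sound : T (not (⌊ i <? j ⌋ ∧ lookup S i ∧ lookup S j) ∨ ⌊ c i j ≟ᵇ col ⌋) → EdgeOK i j
      sound ok i<j Si Sj with i <? j | c i j ≟ᵇ col
      ... | _      | yes ij≡col = ij≡col
      ... | no i≮j | no _       = contradiction i<j i≮j
      ... | yes _  | no _       =
        ⊥-elim (subst₂ (λ x y → T (not (x ∧ y) ∨ false)) ([]=⇒lookup Si) ([]=⇒lookup Sj) ok)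

      complete : EdgeOK i j → T (not (⌊ i <? j ⌋ ∧ lookup S i ∧ lookup S j) ∨ ⌊ c i j ≟ᵇ col ⌋)
      complete ok with i <? j | lookup S i in Si | lookup S j in Sj | c i j ≟ᵇ col
      ... | _       | _     | _     | yes _    = subst T (sym (∨-zeroʳ _)) _
      ... | no _    | _     | _     | no _     = _
      ... | yes _   | false | _     | no _     = _
      ... | yes _   | true  | false | no _     = _
      ... | yes i<j | true  | true  | no ij≢col =
        contradiction (ok i<j (lookup⇒[]= i S Si) (lookup⇒[]= j S Sj)) ij≢col

  T-monoIn : T (monoIn c col S) ⇔ Mono c col S
  T-monoIn = mk⇔
    (λ h {i} {j} → to (T-edgeOK i j) (to T-all-allFin (to T-all-allFin h i) j))
    (λ h → from T-all-allFin λ i → from T-all-allFin λ j → from (T-edgeOK i j) h)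

T-isMonoClique : ∀ {n} {c : Colouring n} {S} → T (isMonoClique c S) ⇔ MonoClique c S
T-isMonoClique {c = c} {S} = mk⇔ sound complete
  where
  sound : T (isMonoClique c S) → MonoClique c S
  sound h with to T-∧ h
  ... | nonempty , mono with to T-∨ mono
  ...   | inj₁ red  = ≤ᵇ⇒≤ 1 ∣ S ∣ nonempty , true , to (T-monoIn c true S) red
  ...   | inj₂ blue = ≤ᵇ⇒≤ 1 ∣ S ∣ nonempty , false , to (T-monoIn c false S) blue

  complete : MonoClique c S → T (isMonoClique c S)
  complete (1≤∣S∣ , true  , red)  =
    from T-∧ (≤⇒≤ᵇ 1≤∣S∣ , from T-∨ (inj₁ (from (T-monoIn c true S) red)))
  complete (1≤∣S∣ , false , blue) =
    from T-∧ (≤⇒≤ᵇ 1≤∣S∣ , from T-∨ (inj₂ (from (T-monoIn c false S) blue)))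

insert : ∀ {n} → Fin n → Subset n → Subset n
insert v R = R [ v ]≔ true

module _ {n} {R : Subset n} {v : Fin n} where

  v∈insert : v ∈ insert v R
  v∈insert = []≔-updates R v

  ∈-insert⁺ : ∀ {x} → x ∈ R → x ∈ insert v R
  ∈-insert⁺ {x} x∈R with x Fin.≟ v
  ... | yes refl = v∈insert
  ... | no x≢v   = []≔-minimal R x v x≢v x∈R

  ∈-insert⁻ : ∀ {x} → x ∈ insert v R → x ≡ v ⊎ x ∈ R
  ∈-insert⁻ {x} x∈ with x Fin.≟ v
  ... | yes x≡v = inj₁ x≡v
  ... | no x≢v  = inj₂ (lookup⇒[]= x R (trans (sym (lookup∘update′ x≢v R true)) ([]=⇒lookup x∈)))

  ∉-insert : ∀ {x} → x ≢ v → x ∉ R → x ∉ insert v R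
  ∉-insert x≢v x∉R x∈ with ∈-insert⁻ x∈
  ... | inj₁ x≡v = x≢v x≡v
  ... | inj₂ x∈R = x∉R x∈R

∈-tabulate⁻ : ∀ {n} {p : Fin n → Bool} {v} → v ∈ tabulate p → p v ≡ true
∈-tabulate⁻ {p = p} {v} v∈ = trans (sym (lookup∘tabulate p v)) ([]=⇒lookup v∈)

∈-tabulate⁺ : ∀ {n} {p : Fin n → Bool} {v} → p v ≡ true → v ∈ tabulate p
∈-tabulate⁺ {p = p} {v} pv = lookup⇒[]= v (tabulate p) (trans (lookup∘tabulate p v) pv)

∣insert∣ : ∀ {n} (R : Subset n) {v} → v ∉ R → ∣ insert v R ∣ ≡ suc ∣ R ∣
∣insert∣ (false ∷ R) {zero}  _   = refl
∣insert∣ (true  ∷ R) {zero}  v∉R = contradiction here v∉R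
∣insert∣ (true  ∷ R) {suc v} v∉R = cong suc (∣insert∣ R (v∉R ∘ there))
∣insert∣ (false ∷ R) {suc v} v∉R = ∣insert∣ R (v∉R ∘ there)

1≤∣p∣⇒member : ∀ {n} (S : Subset n) → 1 ≤ ∣ S ∣ → ∃[ i ] i ∈ S
1≤∣p∣⇒member (true  ∷ S) _ = zero , here
1≤∣p∣⇒member (false ∷ S) h with 1≤∣p∣⇒member S h
... | i , i∈S = suc i , there i∈S

2≤∣p∣⇒pair : ∀ {n} (S : Subset n) → 2 ≤ ∣ S ∣ → ∃[ i ] ∃[ j ] i Fin.< j × i ∈ S × j ∈ S
2≤∣p∣⇒pair (true  ∷ S) (s≤s h) with 1≤∣p∣⇒member S h
... | j , j∈S = zero , suc j , s≤s z≤n , here , there j∈S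
2≤∣p∣⇒pair (false ∷ S) h with 2≤∣p∣⇒pair S h
... | i , j , i<j , i∈S , j∈S = suc i , suc j , s≤s i<j , there i∈S , there j∈S

3≤∣p∣⇒triple : ∀ {n} (S : Subset n) → 3 ≤ ∣ S ∣ →
  ∃[ i ] ∃[ j ] ∃[ k ] i Fin.< j × j Fin.< k × i ∈ S × j ∈ S × k ∈ S
3≤∣p∣⇒triple (true  ∷ S) (s≤s h) with 2≤∣p∣⇒pair S h
... | j , k , j<k , j∈S , k∈S = zero , suc j , suc k , s≤s z≤n , s≤s j<k , here , there j∈S , there k∈S
3≤∣p∣⇒triple (false ∷ S) h with 3≤∣p∣⇒triple S h
... | i , j , k , i<j , j<k , i∈S , j∈S , k∈S =
  suc i , suc j , suc k , s≤s i<j , s≤s j<k , there i∈S , there j∈S , there k∈S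

module _ {n} {c : Colouring n} {col : Bool} where

  Mono-⊆ : ∀ {R S} → R ⊆ S → Mono c col S → Mono c col R
  Mono-⊆ R⊆S monoS i<j i∈R j∈R = monoS i<j (R⊆S i∈R) (R⊆S j∈R)

  Mono-insert : ∀ {R v} → Mono c col R →
    (∀ {x} → x ∈ R → x Fin.< v → c x v ≡ col) →
    (∀ {y} → y ∈ R → v Fin.< y → c v y ≡ col) →
    Mono c col (insert v R)
  Mono-insert monoR below above i<j i∈ j∈ with ∈-insert⁻ i∈ | ∈-insert⁻ j∈
  ... | inj₁ refl | inj₁ refl = contradiction i<j (Fin.<-irrefl refl)
  ... | inj₁ refl | inj₂ j∈R  = above j∈R i<j
  ... | inj₂ i∈R  | inj₁ refl = below i∈R i<j
  ... | inj₂ i∈R  | inj₂ j∈R  = monoR i<j i∈R j∈R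

  Mono-insert₂ : ∀ {R v w} → v Fin.< w → c v w ≡ col →
    Mono c col (insert v R) → Mono c col (insert w R) → Mono c col (insert w (insert v R))
  Mono-insert₂ {R} {v} {w} v<w vw≡col monoᵛ monoʷ = Mono-insert monoᵛ below above
    where
    below : ∀ {x} → x ∈ insert v R → x Fin.< w → c x w ≡ col
    below x∈ x<w with ∈-insert⁻ x∈
    ... | inj₁ refl = vw≡col
    ... | inj₂ x∈R  = monoʷ x<w (∈-insert⁺ x∈R) v∈insert

    above : ∀ {y} → y ∈ insert v R → w Fin.< y → c w y ≡ col
    above y∈ w<y with ∈-insert⁻ y∈
    ... | inj₁ refl = contradiction v<w (Fin.<-asym w<y)
    ... | inj₂ y∈R  = monoʷ w<y v∈insert (∈-insert⁺ y∈R)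

  Mono-singleton : ∀ {v} → Mono c col (insert v ⊥)
  Mono-singleton i<j i∈ j∈ with ∈-insert⁻ i∈ | ∈-insert⁻ j∈
  ... | inj₁ refl | inj₁ refl = contradiction i<j (Fin.<-irrefl refl)
  ... | inj₂ i∈⊥  | _         = contradiction i∈⊥ ∉⊥
  ... | _         | inj₂ j∈⊥  = contradiction j∈⊥ ∉⊥

Mono-unique : ∀ {n} {c : Colouring n} {col col′ R} → 2 ≤ ∣ R ∣ → Mono c col R → Mono c col′ R → col ≡ col′
Mono-unique {R = R} 2≤∣R∣ mono mono′ with 2≤∣p∣⇒pair R 2≤∣R∣
... | _ , _ , i<j , i∈R , j∈R = trans (sym (mono i<j i∈R j∈R)) (mono′ i<j i∈R j∈R)

sumSubsets : ∀ {n} → (Subset n → ℕ) → ℕ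
sumSubsets {zero}  f = f []
sumSubsets {suc n} f = sumSubsets (λ S → f (true ∷ S)) + sumSubsets (λ S → f (false ∷ S))

sumFin : ∀ {n} → (Fin n → ℕ) → ℕ
sumFin {zero}  g = 0
sumFin {suc n} g = g zero + sumFin (λ v → g (suc v))

sumSubsets-cong : ∀ {n} {f g : Subset n → ℕ} → (∀ S → f S ≡ g S) → sumSubsets f ≡ sumSubsets g
sumSubsets-cong {zero}  f≗g = f≗g []
sumSubsets-cong {suc n} f≗g = cong₂ _+_ (sumSubsets-cong (f≗g ∘ (true ∷_))) (sumSubsets-cong (f≗g ∘ (false ∷_)))

sumSubsets-mono-≤ : ∀ {n} {f g : Subset n → ℕ} → (∀ S → f S ≤ g S) → sumSubsets f ≤ sumSubsets g
sumSubsets-mono-≤ {zero}  f≤g = f≤g []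
sumSubsets-mono-≤ {suc n} f≤g =
  +-mono-≤ (sumSubsets-mono-≤ (f≤g ∘ (true ∷_))) (sumSubsets-mono-≤ (f≤g ∘ (false ∷_)))

sumSubsets-distrib-+ : ∀ {n} (f g : Subset n → ℕ) → sumSubsets (λ S → f S + g S) ≡ sumSubsets f + sumSubsets g
sumSubsets-distrib-+ {zero}  f g = refl
sumSubsets-distrib-+ {suc n} f g = trans
  (cong₂ _+_ (sumSubsets-distrib-+ (f ∘ (true ∷_)) (g ∘ (true ∷_)))
             (sumSubsets-distrib-+ (f ∘ (false ∷_)) (g ∘ (false ∷_))))
  (interchange (sumSubsets (f ∘ (true ∷_))) (sumSubsets (g ∘ (true ∷_))) _ _)

sumSubsets-*ˡ : ∀ {n} k (f : Subset n → ℕ) → sumSubsets (λ S → k * f S) ≡ k * sumSubsets f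
sumSubsets-*ˡ {zero}  k f = refl
sumSubsets-*ˡ {suc n} k f = trans
  (cong₂ _+_ (sumSubsets-*ˡ k (f ∘ (true ∷_))) (sumSubsets-*ˡ k (f ∘ (false ∷_))))
  (sym (*-distribˡ-+ k _ _))

sumFin-cong : ∀ {n} {f g : Fin n → ℕ} → (∀ v → f v ≡ g v) → sumFin f ≡ sumFin g
sumFin-cong {zero}  f≗g = refl
sumFin-cong {suc n} f≗g = cong₂ _+_ (f≗g zero) (sumFin-cong (f≗g ∘ suc))

sumFin-iverson : ∀ {n} (p : Fin n → Bool) → sumFin (iverson ∘ p) ≡ ∣ tabulate p ∣
sumFin-iverson {zero}  p = refl
sumFin-iverson {suc n} p with p zero
... | true  = cong suc (sumFin-iverson (p ∘ suc))
... | false = sumFin-iverson (p ∘ suc)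

sum-map-allSubsets : ∀ n (f : Subset n → ℕ) → sum (map f (allSubsets n)) ≡ sumSubsets f
sum-map-allSubsets zero    f = +-identityʳ (f [])
sum-map-allSubsets (suc n) f = begin
  sum (map f (map (true ∷_) Ss ++ map (false ∷_) Ss))
    ≡⟨ cong sum (map-++ f (map (true ∷_) Ss) _) ⟩
  sum (map f (map (true ∷_) Ss) ++ map f (map (false ∷_) Ss))
    ≡⟨ sum-++ (map f (map (true ∷_) Ss)) _ ⟩
  sum (map f (map (true ∷_) Ss)) + sum (map f (map (false ∷_) Ss))
    ≡⟨ cong₂ _+_ (cong sum (sym (map-∘ Ss))) (cong sum (sym (map-∘ Ss))) ⟩
  sum (map (f ∘ (true ∷_)) Ss) + sum (map (f ∘ (false ∷_)) Ss)
    ≡⟨ cong₂ _+_ (sum-map-allSubsets n _) (sum-map-allSubsets n _) ⟩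
  sumSubsets (f ∘ (true ∷_)) + sumSubsets (f ∘ (false ∷_)) ∎
  where
  open ≡-Reasoning
  Ss = allSubsets n

module _ {A : Set} (p : A → Bool) where

  length-filterᵇ : ∀ xs → length (filterᵇ p xs) ≡ sum (map (iverson ∘ p) xs)
  length-filterᵇ []       = refl
  length-filterᵇ (x ∷ xs) with p x
  ... | true  = cong suc (length-filterᵇ xs)
  ... | false = length-filterᵇ xs

  sum-map-filterᵇ : ∀ (f : A → ℕ) xs → sum (map f (filterᵇ p xs)) ≡ sum (map (λ x → iverson (p x) * f x) xs)
  sum-map-filterᵇ f []       = refl
  sum-map-filterᵇ f (x ∷ xs) with p x
  ... | true  = cong₂ _+_ (sym (+-identityʳ (f x))) (sum-map-filterᵇ f xs)
  ... | false = sum-map-filterᵇ f xs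

numMono≡sumSubsets : ∀ {n} (c : Colouring n) → numMono c ≡ sumSubsets (iverson ∘ isMonoClique c)
numMono≡sumSubsets {n} c = trans (length-filterᵇ (isMonoClique c) (allSubsets n)) (sum-map-allSubsets n _)

totalSize≡sumSubsets : ∀ {n} (c : Colouring n) →
  totalSize c ≡ sumSubsets (λ S → iverson (isMonoClique c S) * ∣ S ∣)
totalSize≡sumSubsets {n} c = trans (sum-map-filterᵇ (isMonoClique c) ∣_∣ (allSubsets n)) (sum-map-allSubsets n _)

∈⇒≤foldr-⊔ : ∀ {m ms} → m List.∈ ms → m ≤ foldr _⊔_ 0 ms
∈⇒≤foldr-⊔ {ms = m ∷ _}  (Any.here refl)  = m≤m⊔n m _
∈⇒≤foldr-⊔ {ms = m′ ∷ _} (Any.there m∈ms) = ≤-trans (∈⇒≤foldr-⊔ m∈ms) (m≤n⊔m m′ _)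

∈-allSubsets : ∀ n (S : Subset n) → S List.∈ allSubsets n
∈-allSubsets zero    []          = Any.here refl
∈-allSubsets (suc n) (true  ∷ S) = ∈-++⁺ˡ (∈-map⁺ (true ∷_) (∈-allSubsets n S))
∈-allSubsets (suc n) (false ∷ S) = ∈-++⁺ʳ (map (true ∷_) (allSubsets n)) (∈-map⁺ (false ∷_) (∈-allSubsets n S))

∣S∣≤M : ∀ {n} (c : Colouring n) {S} → MonoClique c S → ∣ S ∣ ≤ M c
∣S∣≤M {n} c {S} clique = ∈⇒≤foldr-⊔
  (∈-map⁺ ∣_∣ (∈-filter⁺ (T? ∘ isMonoClique c) (∈-allSubsets n S) (from (T-isMonoClique {c = c} {S}) clique)))

-- A set S with a chosen element v is the same as a set R = S − v with a chosen vertex v ∉ R.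
double-count-insert : ∀ {n} (f : Subset n → ℕ) →
  sumSubsets (λ S → f S * ∣ S ∣) ≡ sumSubsets (λ R → sumFin (λ v → iverson (not (lookup R v)) * f (insert v R)))
double-count-insert {zero}  f = *-zeroʳ (f [])
double-count-insert {suc n} f = begin
  sumSubsets (λ S → f (true ∷ S) * suc ∣ S ∣) + sumSubsets (λ S → f (false ∷ S) * ∣ S ∣)
    ≡⟨ cong (_+ sumSubsets (λ S → f (false ∷ S) * ∣ S ∣))
         (trans (sumSubsets-cong (λ S → *-suc (f (true ∷ S)) ∣ S ∣))
                (sumSubsets-distrib-+ (f ∘ (true ∷_)) (λ S → f (true ∷ S) * ∣ S ∣))) ⟩
  (A + sumSubsets (λ S → f (true ∷ S) * ∣ S ∣)) + sumSubsets (λ S → f (false ∷ S) * ∣ S ∣)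
    ≡⟨ cong₂ (λ x y → (A + x) + y) (double-count-insert (f ∘ (true ∷_))) (double-count-insert (f ∘ (false ∷_))) ⟩
  (A + Xᵗ) + Xᶠ
    ≡⟨ trans (cong (_+ Xᶠ) (+-comm A Xᵗ)) (+-assoc Xᵗ A Xᶠ) ⟩
  Xᵗ + (A + Xᶠ)
    ≡⟨ cong (λ x → Xᵗ + (x + Xᶠ)) (sumSubsets-cong (λ R → sym (*-identityˡ (f (true ∷ R))))) ⟩
  Xᵗ + (sumSubsets (λ R → 1 * f (true ∷ R)) + Xᶠ)
    ≡⟨ cong (Xᵗ +_) (sym (sumSubsets-distrib-+ (λ R → 1 * f (true ∷ R)) _)) ⟩
  Xᵗ + sumSubsets (λ R → 1 * f (true ∷ R) + sumFin (λ v → iverson (not (lookup R v)) * f (false ∷ insert v R))) ∎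
  where
  open ≡-Reasoning
  A  = sumSubsets (λ S → f (true ∷ S))
  Xᵗ = sumSubsets (λ R → sumFin (λ v → iverson (not (lookup R v)) * f (true ∷ insert v R)))
  Xᶠ = sumSubsets (λ R → sumFin (λ v → iverson (not (lookup R v)) * f (false ∷ insert v R)))

isMonoCliqueOfSize : ∀ {n} → Colouring n → ℕ → Subset n → Bool
isMonoCliqueOfSize c s S = isMonoClique c S ∧ ⌊ ∣ S ∣ ≟ s ⌋

#MonoCliquesOfSize : ∀ {n} → Colouring n → ℕ → ℕ
#MonoCliquesOfSize c s = sumSubsets (iverson ∘ isMonoCliqueOfSize c s)

T-isMonoCliqueOfSize : ∀ {n} {c : Colouring n} {s S} → T (isMonoCliqueOfSize c s S) ⇔ (MonoClique c S × ∣ S ∣ ≡ s)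
T-isMonoCliqueOfSize = mk⇔
  (λ h → let clique , size = to T-∧ h in to T-isMonoClique clique , toWitness size)
  (λ (clique , size) → from T-∧ (from T-isMonoClique clique , fromWitness size))

iverson-ofSize-* : ∀ {n} (c : Colouring n) s S →
  iverson (isMonoCliqueOfSize c s S) * ∣ S ∣ ≡ s * iverson (isMonoCliqueOfSize c s S)
iverson-ofSize-* c s S with isMonoCliqueOfSize c s S | to (T-isMonoCliqueOfSize {c = c} {s} {S})
... | false | _    = sym (*-zeroʳ s)
... | true  | spec = trans (*-identityˡ ∣ S ∣) (trans (proj₂ (spec _)) (sym (*-identityʳ s)))

size-weight-bound : ∀ {s m} → s ≤ suc m → 2 * s + 1 + iverson ⌊ s ≟ m ⌋ ≤ 2 * suc m + iverson ⌊ s ≟ suc m ⌋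
size-weight-bound {s} {m} s≤1+m with s ≟ suc m | s ≟ m
... | yes refl | yes 1+m≡m = contradiction 1+m≡m 1+n≢n
... | yes refl | no _      = ≤-reflexive (+-identityʳ _)
... | no _     | yes refl  = ≤-reflexive (2m+1+1≡2[1+m]+0 m)
  where
  2m+1+1≡2[1+m]+0 : ∀ m → 2 * m + 1 + 1 ≡ 2 * suc m + 0
  2m+1+1≡2[1+m]+0 = solve-∀
... | no s≢1+m | no _      = begin
  2 * s + 1 + 0    ≡⟨ +-identityʳ _ ⟩
  2 * s + 1        ≤⟨ +-mono-≤ (*-monoʳ-≤ 2 (≤-pred (≤∧≢⇒< s≤1+m s≢1+m))) (n≤1+n 1) ⟩
  2 * m + 2        ≡⟨ 2m+2≡2[1+m]+0 m ⟩
  2 * suc m + 0    ∎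
  where
  open ≤-Reasoning
  2m+2≡2[1+m]+0 : ∀ m → 2 * m + 2 ≡ 2 * suc m + 0
  2m+2≡2[1+m]+0 = solve-∀

module MaximumCliques {n} (c : Colouring n) (m : ℕ) (2≤m : 2 ≤ m)
  (bounded : ∀ {S} → MonoClique c S → ∣ S ∣ ≤ suc m) where

  extensions : Subset n → Subset n
  extensions R = tabulate (λ v → not (lookup R v) ∧ isMonoCliqueOfSize c (suc m) (insert v R))

  ∈-extensions⁻ : ∀ {R v} → v ∈ extensions R → v ∉ R × ∃[ col ] Mono c col (insert v R) × ∣ R ∣ ≡ m
  ∈-extensions⁻ {R} {v} v∈ with to T-∧ (from T-≡ (∈-tabulate⁻ v∈))
  ... | v∉R , top with to T-isMonoCliqueOfSize top
  ...   | (_ , col , mono) , size = v∉R′ , col , mono , suc-injective (trans (sym (∣insert∣ R v∉R′)) size)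
    where
    v∉R′ : v ∉ R
    v∉R′ v∈R = subst (T ∘ not) ([]=⇒lookup v∈R) v∉R

  extensions-Mono : ∀ {R col} → Mono c col R → ∣ R ∣ ≡ m → Mono c (not col) (extensions R)
  extensions-Mono {R} {col} monoR ∣R∣≡m {v} {w} v<w v∈ w∈
    with ∈-extensions⁻ v∈ | ∈-extensions⁻ w∈ | c v w ≟ᵇ col
  ... | _ | _ | no vw≢col = ¬-not vw≢col
  ... | v∉R , _ , monoᵛ , _ | w∉R , _ , monoʷ , _ | yes vw≡col =
    contradiction (subst (_≤ suc m) size (bounded (subst (1 ≤_) (sym size) (s≤s z≤n) , col , mono))) 1+n≰n
    where
    same-colour : ∀ {col′ u} → Mono c col′ (insert u R) → Mono c col (insert u R)
    same-colour {col′} {u} mono′ = subst (λ k → Mono c k (insert u R))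
      (sym (Mono-unique (subst (2 ≤_) (sym ∣R∣≡m) 2≤m) monoR (Mono-⊆ ∈-insert⁺ mono′))) mono′

    mono : Mono c col (insert w (insert v R))
    mono = Mono-insert₂ v<w vw≡col (same-colour monoᵛ) (same-colour monoʷ)

    size : ∣ insert w (insert v R) ∣ ≡ suc (suc m)
    size = begin
      ∣ insert w (insert v R) ∣ ≡⟨ ∣insert∣ (insert v R) (∉-insert (≢-sym (Fin.<⇒≢ v<w)) w∉R) ⟩
      suc ∣ insert v R ∣       ≡⟨ cong suc (∣insert∣ R v∉R) ⟩
      suc (suc ∣ R ∣)          ≡⟨ cong (λ k → suc (suc k)) ∣R∣≡m ⟩
      suc (suc m)              ∎
      where open ≡-Reasoning

  sumFin≡∣extensions∣ : ∀ R →
    sumFin (λ v → iverson (not (lookup R v)) * iverson (isMonoCliqueOfSize c (suc m) (insert v R)))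
      ≡ ∣ extensions R ∣
  sumFin≡∣extensions∣ R = trans
    (sumFin-cong {n} (λ v → sym (iverson-∧ (not (lookup R v)) (isMonoCliqueOfSize c (suc m) (insert v R)))))
    (sumFin-iverson (λ v → not (lookup R v) ∧ isMonoCliqueOfSize c (suc m) (insert v R)))

  ∣extensions∣≤ : ∀ R → ∣ extensions R ∣ ≤ suc m * iverson (isMonoCliqueOfSize c m R)
  ∣extensions∣≤ R with 1 ≤? ∣ extensions R ∣
  ... | no 1≰∣E∣ = ≤-trans (≤-pred (≰⇒> 1≰∣E∣)) z≤n
  ... | yes 1≤∣E∣ with 1≤∣p∣⇒member (extensions R) 1≤∣E∣
  ...   | _ , v∈ with ∈-extensions⁻ v∈
  ...     | _ , col , monoᵛ , ∣R∣≡m = begin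
    ∣ extensions R ∣ ≤⟨ bounded (1≤∣E∣ , not col , extensions-Mono monoR ∣R∣≡m) ⟩
    suc m            ≡⟨ sym (*-identityʳ (suc m)) ⟩
    suc m * 1        ≡⟨ cong (suc m *_) (sym (iverson-T (from T-isMonoCliqueOfSize (cliqueR , ∣R∣≡m)))) ⟩
    suc m * iverson (isMonoCliqueOfSize c m R) ∎
    where
    open ≤-Reasoning
    monoR : Mono c col R
    monoR = Mono-⊆ ∈-insert⁺ monoᵛ
    cliqueR : MonoClique c R
    cliqueR = subst (1 ≤_) (sym ∣R∣≡m) (≤-trans (s≤s z≤n) 2≤m) , col , monoR

  #maximum≤#submaximum : #MonoCliquesOfSize c (suc m) ≤ #MonoCliquesOfSize c m
  #maximum≤#submaximum = *-cancelˡ-≤ (suc m) (begin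
    suc m * #MonoCliquesOfSize c (suc m)
      ≡⟨ sym (sumSubsets-*ˡ (suc m) top) ⟩
    sumSubsets (λ S → suc m * top S)
      ≡⟨ sumSubsets-cong (λ S → sym (iverson-ofSize-* c (suc m) S)) ⟩
    sumSubsets (λ S → top S * ∣ S ∣)
      ≡⟨ double-count-insert top ⟩
    sumSubsets (λ R → sumFin (λ v → iverson (not (lookup R v)) * top (insert v R)))
      ≡⟨ sumSubsets-cong sumFin≡∣extensions∣ ⟩
    sumSubsets (λ R → ∣ extensions R ∣)
      ≤⟨ sumSubsets-mono-≤ ∣extensions∣≤ ⟩
    sumSubsets (λ R → suc m * iverson (isMonoCliqueOfSize c m R))
      ≡⟨ sumSubsets-*ˡ (suc m) (iverson ∘ isMonoCliqueOfSize c m) ⟩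
    suc m * #MonoCliquesOfSize c m ∎)
    where
    open ≤-Reasoning
    top : Subset n → ℕ
    top = iverson ∘ isMonoCliqueOfSize c (suc m)

  clique-weight-bound : ∀ S →
    2 * (iverson (isMonoClique c S) * ∣ S ∣) + iverson (isMonoClique c S) + iverson (isMonoCliqueOfSize c m S)
      ≤ 2 * suc m * iverson (isMonoClique c S) + iverson (isMonoCliqueOfSize c (suc m) S)
  clique-weight-bound S with isMonoClique c S | bounded {S} ∘ to T-isMonoClique
  ... | false | _     = z≤n
  ... | true  | ∣S∣≤ = subst₂ _≤_
    (cong (λ x → 2 * x + 1 + iverson ⌊ ∣ S ∣ ≟ m ⌋) (sym (*-identityˡ ∣ S ∣)))
    (cong (_+ iverson ⌊ ∣ S ∣ ≟ suc m ⌋) (sym (*-identityʳ (2 * suc m))))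
    (size-weight-bound (∣S∣≤ _))

cliqueSizes-bound : ∀ {n} (c : Colouring n) m → 3 ≤ m → (∀ {S} → MonoClique c S → ∣ S ∣ ≤ m) →
  2 * sumSubsets (λ S → iverson (isMonoClique c S) * ∣ S ∣) + sumSubsets (iverson ∘ isMonoClique c)
    ≤ 2 * m * sumSubsets (iverson ∘ isMonoClique c)
cliqueSizes-bound c (suc m) (s≤s 2≤m) bounded = +-cancelʳ-≤ (#MonoCliquesOfSize c m) _ _ (begin
  2 * sumSubsets size + sumSubsets k + sumSubsets sub
    ≡⟨ cong (λ x → x + sumSubsets k + sumSubsets sub) (sym (sumSubsets-*ˡ 2 size)) ⟩
  sumSubsets (λ S → 2 * size S) + sumSubsets k + sumSubsets sub
    ≡⟨ cong (_+ sumSubsets sub) (sym (sumSubsets-distrib-+ (λ S → 2 * size S) k)) ⟩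
  sumSubsets (λ S → 2 * size S + k S) + sumSubsets sub
    ≡⟨ sym (sumSubsets-distrib-+ (λ S → 2 * size S + k S) sub) ⟩
  sumSubsets (λ S → 2 * size S + k S + sub S)
    ≤⟨ sumSubsets-mono-≤ clique-weight-bound ⟩
  sumSubsets (λ S → 2 * suc m * k S + top S)
    ≡⟨ sumSubsets-distrib-+ (λ S → 2 * suc m * k S) top ⟩
  sumSubsets (λ S → 2 * suc m * k S) + sumSubsets top
    ≡⟨ cong (_+ sumSubsets top) (sumSubsets-*ˡ (2 * suc m) k) ⟩
  2 * suc m * sumSubsets k + sumSubsets top
    ≤⟨ +-monoʳ-≤ (2 * suc m * sumSubsets k) #maximum≤#submaximum ⟩
  2 * suc m * sumSubsets k + sumSubsets sub ∎)
  where
  open MaximumCliques c m 2≤m bounded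
  open ≤-Reasoning
  k size top sub : Subset _ → ℕ
  k    = iverson ∘ isMonoClique c
  size = λ S → k S * ∣ S ∣
  top  = iverson ∘ isMonoCliqueOfSize c (suc m)
  sub  = iverson ∘ isMonoCliqueOfSize c m

MonoTriangle : ∀ {n} → Colouring n → Set
MonoTriangle c = ∃[ i ] ∃[ j ] ∃[ k ] i Fin.< j × j Fin.< k × ∃[ col ] c i j ≡ col × c i k ≡ col × c j k ≡ col

monoTriangle-fromStar : ∀ {n} {c : Colouring n} {p q r s col} → p Fin.< q → q Fin.< r → r Fin.< s →
  c p q ≡ col → c p r ≡ col → c p s ≡ col → MonoTriangle c
monoTriangle-fromStar {c = c} {p} {q} {r} {s} {col} p<q q<r r<s pq pr ps
  with c q r ≟ᵇ col | c q s ≟ᵇ col | c r s ≟ᵇ col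
... | yes qr | _      | _      = p , q , r , p<q , q<r , col , pq , pr , qr
... | no _   | yes qs | _      = p , q , s , p<q , Fin.<-trans q<r r<s , col , pq , ps , qs
... | no _   | no _   | yes rs = p , r , s , Fin.<-trans p<q q<r , r<s , col , pr , ps , rs
... | no qr  | no qs  | no rs  = q , r , s , q<r , r<s , not col , ¬-not qr , ¬-not qs , ¬-not rs

monoTriangle-fromNeighbours : ∀ {n} (c : Colouring (suc n)) col (S : Subset n) → 3 ≤ ∣ S ∣ →
  (∀ {v} → v ∈ S → c zero (suc v) ≡ col) → MonoTriangle c
monoTriangle-fromNeighbours c col S 3≤∣S∣ coloured with 3≤∣p∣⇒triple S 3≤∣S∣
... | p , q , r , p<q , q<r , p∈S , q∈S , r∈S =
  monoTriangle-fromStar (s≤s z≤n) (s≤s p<q) (s≤s q<r) (coloured p∈S) (coloured q∈S) (coloured r∈S)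

3≤∣p∣⊎3≤∣∁p∣ : ∀ {n} (S : Subset (5 + n)) → 3 ≤ ∣ S ∣ ⊎ 3 ≤ ∣ ∁ S ∣
3≤∣p∣⊎3≤∣∁p∣ {n} S with 3 ≤? ∣ S ∣ | 3 ≤? ∣ ∁ S ∣
... | yes 3≤∣S∣ | _          = inj₁ 3≤∣S∣
... | no _      | yes 3≤∣∁S∣ = inj₂ 3≤∣∁S∣
... | no 3≰∣S∣  | no 3≰∣∁S∣  = contradiction
  (subst (_≤ 4) ∣S∣+∣∁S∣≡5+n (+-mono-≤ (≤-pred (≰⇒> 3≰∣S∣)) (≤-pred (≰⇒> 3≰∣∁S∣))))
  (<⇒≱ (m≤m+n 5 n))
  where
  ∣S∣+∣∁S∣≡5+n : ∣ S ∣ + ∣ ∁ S ∣ ≡ 5 + n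
  ∣S∣+∣∁S∣≡5+n = trans (cong (∣ S ∣ +_) (∣∁p∣≡n∸∣p∣ S)) (m+[n∸m]≡n (∣p∣≤n S))

redNeighboursOfZero : ∀ {n} → Colouring (suc n) → Subset n
redNeighboursOfZero c = tabulate (λ v → c zero (suc v))

monoTriangle : ∀ {n} → 6 ≤ n → (c : Colouring n) → MonoTriangle c
monoTriangle (s≤s (s≤s (s≤s (s≤s (s≤s (s≤s _)))))) c with 3≤∣p∣⊎3≤∣∁p∣ (redNeighboursOfZero c)
... | inj₁ 3≤∣N∣  = monoTriangle-fromNeighbours c true (redNeighboursOfZero c) 3≤∣N∣
  (∈-tabulate⁻ {p = λ v → c zero (suc v)})
... | inj₂ 3≤∣∁N∣ = monoTriangle-fromNeighbours c false (∁ (redNeighboursOfZero c)) 3≤∣∁N∣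
  (λ v∈∁N → ¬-not (x∈∁p⇒x∉p v∈∁N ∘ ∈-tabulate⁺ {p = λ v → c zero (suc v)}))

monoTriangle⇒MonoClique : ∀ {n} {c : Colouring n} → MonoTriangle c → ∃[ S ] MonoClique c S × 3 ≤ ∣ S ∣
monoTriangle⇒MonoClique {n} {c} (i , j , k , i<j , j<k , col , ij , ik , jk) =
  S , (≤-trans (s≤s z≤n) 3≤∣S∣ , col , mono) , 3≤∣S∣
  where
  S : Subset n
  S = insert k (insert j (insert i ⊥))

  mono : Mono c col S
  mono = Mono-insert₂ {c = c} j<k jk
    (Mono-insert₂ i<j ij (Mono-singleton {c = c}) (Mono-singleton {c = c}))
    (Mono-insert₂ (Fin.<-trans i<j j<k) ik (Mono-singleton {c = c}) (Mono-singleton {c = c}))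

  3≤∣S∣ : 3 ≤ ∣ S ∣
  3≤∣S∣ = ≤-reflexive (sym (begin
    ∣ S ∣                         ≡⟨ ∣insert∣ (insert j (insert i ⊥)) k∉ ⟩
    suc ∣ insert j (insert i ⊥) ∣ ≡⟨ cong suc (∣insert∣ (insert i ⊥) j∉) ⟩
    2 + ∣ insert i ⊥ ∣            ≡⟨ cong (2 +_) (∣insert∣ (⊥ {n}) ∉⊥) ⟩
    3 + ∣ ⊥ {n} ∣                 ≡⟨ cong (3 +_) (∣⊥∣≡0 n) ⟩
    3                             ∎))
    where
    open ≡-Reasoning
    j∉ : j ∉ insert i ⊥
    j∉ = ∉-insert (≢-sym (Fin.<⇒≢ i<j)) ∉⊥
    k∉ : k ∉ insert j (insert i ⊥)
    k∉ = ∉-insert (≢-sym (Fin.<⇒≢ j<k)) (∉-insert (≢-sym (Fin.<⇒≢ (Fin.<-trans i<j j<k))) ∉⊥)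

3≤M : ∀ {n} → 6 ≤ n → (c : Colouring n) → 3 ≤ M c
3≤M 6≤n c with monoTriangle⇒MonoClique (monoTriangle 6≤n c)
... | _ , clique , 3≤∣S∣ = ≤-trans 3≤∣S∣ (∣S∣≤M c clique)

mainTheorem20 : (n : ℕ) → 6 ≤ n → (c : Colouring n) →
    2 * totalSize c + numMono c ≤ 2 * M c * numMono c
mainTheorem20 n 6≤n c =
  subst₂ (λ t N → 2 * t + N ≤ 2 * M c * N) (sym (totalSize≡sumSubsets c)) (sym (numMono≡sumSubsets c))
    (cliqueSizes-bound c (M c) (3≤M 6≤n c) (∣S∣≤M c))
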